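{- Let $\Lambda$ be a finite distributive lattice and $\Gamma$ the generic $\Lambda$-ultrametric space. Let $E,F_1,F_2\in\Lambda$ with $E=F_1\wedge F_2$. Then a subquotient order $<_{F_1,F_1\vee F_2}$ on $\Gamma$ with bottom relation $F_1$ and top relation $F_1\vee F_2$ induces a subquotient order on $\Gamma$ with bottom relation $E$ and top relation $F_2$ that is definable in $(\Gamma,<_{F_1,F_1\vee F_2})$.
   Context: For a finite lattice $\Lambda$ with bottom $\mathbb{0}$ and top $\mathbb{1}$, a $\Lambda$-ultrametric space is a set $X$ with $d:X\times X\to\Lambda$ such that $d(x,y)=\mathbb{0}$ iff $x=y$, $d$ is symmetric, and $d(x,z)\le d(x,y)\vee d(y,z)$; each $\lambda\in\Lambda$ is identified with the equivalence relation $\{(x,y):d(x,y)\le\lambda\}$. For finite distributive $\Lambda$ the class of all finite $\Lambda$-ultrametric spaces (with a binary relation for each distance) is a Fraïssé class, and its Fraïssé limit is the generic $\Lambda$-ultrametric space. A subquotient order with bottom relation $E$ and top relation $F$ ($E\le F$ equivalence relations on $X$) is a partial order on $X/E$ in which two $E$-classes are comparable iff they lie in the same $F$-class, regarded as a binary relation on $X$ via $x<y$ iff $x/E<y/E$. -}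

module Defs where

open import Level using (0ℓ)
open import Data.Nat using (ℕ; suc)
open import Data.Fin using (Fin; zero; suc; inject₁; fromℕ)
open import Data.Product using (Σ; ∃; _×_; _,_)
open import Data.Sum using (_⊎_)
open import Data.Empty renaming (⊥ to Empty)
open import Data.Unit renaming (⊤ to Unit)
open import Relation.Nullary using (¬_)
open import Relation.Binary.PropositionalEquality using (_≡_)
open import Relation.Binary.Lattice.Bundles using (BoundedLattice)
open import Algebra.Definitions using (_DistributesOverˡ_)
open import Function.Base using (_∘_)

record FinDistLattice : Set₁ where
  field
    L : BoundedLattice 0ℓ 0ℓ 0ℓ
  open BoundedLattice L public
  field
    ∧-distribˡ-∨ : _DistributesOverˡ_ _≈_ _∧_ _∨_
    size         : ℕ
    enum         : Fin size → Carrier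
    enum-onto    : ∀ (a : Carrier) → Σ (Fin size) (λ i → enum i ≈ a)

module _ (Λ : FinDistLattice) where
  open FinDistLattice Λ

  record IsUltrametric {X : Set} (d : X → X → Carrier) : Set where
    field
      zero⇒eq  : ∀ x y → d x y ≈ ⊥ → x ≡ y
      eq⇒zero  : ∀ x → d x x ≈ ⊥
      sym      : ∀ x y → d x y ≈ d y x
      ultra    : ∀ x y z → d x z ≤ (d x y ∨ d y z)

  record UltrametricSpace : Set₁ where
    field
      Pt   : Set
      dist : Pt → Pt → Carrier
      isUltrametric : IsUltrametric dist

  -- The equivalence relation on a space identified with λ ∈ Λ.
  rel : {X : Set} → (X → X → Carrier) → Carrier → X → X → Set
  rel d l x y = d x y ≤ l

  -- Generic Λ-ultrametric space (Fraïssé limit of the class of finite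
  -- Λ-ultrametric spaces), characterised as usual: a countable Λ-ultrametric
  -- space with the one-point extension property for finite Λ-ultrametric spaces.
  record IsGeneric (Γ : UltrametricSpace) : Set where
    open UltrametricSpace Γ
    field
      countable : Σ (ℕ → Pt) (λ e → ∀ x → Σ ℕ (λ k → e k ≡ x))
      extension : ∀ (n : ℕ) (dB : Fin (suc n) → Fin (suc n) → Carrier) →
                  IsUltrametric dB →
                  (f : Fin n → Pt) →
                  (∀ i j → dist (f i) (f j) ≈ dB (inject₁ i) (inject₁ j)) →
                  Σ Pt (λ x → ∀ i → dist (f i) x ≈ dB (inject₁ i) (fromℕ n))

  -- Subquotient order with bottom relation E and top relation F on a space,
  -- as a (strict) binary relation on points: x < y iff x/E < y/E.
  record IsSubquotientOrder {X : Set} (d : X → X → Carrier) (E F : Carrier)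
                            (R : X → X → Set) : Set where
    field
      E≤F      : E ≤ F
      respects : ∀ x x' y y' → rel d E x x' → rel d E y y' → R x y → R x' y'
      irrefl   : ∀ x → ¬ R x x
      trans    : ∀ x y z → R x y → R y z → R x z
      comparable⇒F : ∀ x y → R x y → rel d F x y
      F⇒comparable : ∀ x y → rel d F x y → rel d E x y ⊎ (R x y ⊎ R y x)

  data Formula : ℕ → Set where
    dist≤ : ∀ {n} → Carrier → Fin n → Fin n → Formula n
    lt    : ∀ {n} → Fin n → Fin n → Formula n
    equ   : ∀ {n} → Fin n → Fin n → Formula n
    fals  : ∀ {n} → Formula n
    tru   : ∀ {n} → Formula n
    neg   : ∀ {n} → Formula n → Formula n
    and   : ∀ {n} → Formula n → Formula n → Formula n
    or    : ∀ {n} → Formula n → Formula n → Formula n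
    imp   : ∀ {n} → Formula n → Formula n → Formula n
    all   : ∀ {n} → Formula (suc n) → Formula n
    ex    : ∀ {n} → Formula (suc n) → Formula n

  extend : {X : Set} {n : ℕ} → (Fin n → X) → X → Fin (suc n) → X
  extend ρ x zero    = x
  extend ρ x (suc i) = ρ i

  ⟦_⟧ : ∀ {X : Set} {n} → Formula n → (X → X → Carrier) → (X → X → Set) →
        (Fin n → X) → Set
  ⟦ dist≤ l i j ⟧ d R ρ = d (ρ i) (ρ j) ≤ l
  ⟦ lt i j ⟧      d R ρ = R (ρ i) (ρ j)
  ⟦ equ i j ⟧     d R ρ = ρ i ≡ ρ j
  ⟦ fals ⟧        d R ρ = Empty
  ⟦ tru ⟧         d R ρ = Unit
  ⟦ neg φ ⟧       d R ρ = ¬ ⟦ φ ⟧ d R ρ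
  ⟦ and φ ψ ⟧     d R ρ = ⟦ φ ⟧ d R ρ × ⟦ ψ ⟧ d R ρ
  ⟦ or φ ψ ⟧      d R ρ = ⟦ φ ⟧ d R ρ ⊎ ⟦ ψ ⟧ d R ρ
  ⟦ imp φ ψ ⟧     d R ρ = ⟦ φ ⟧ d R ρ → ⟦ ψ ⟧ d R ρ
  ⟦ all φ ⟧       d R ρ = ∀ x → ⟦ φ ⟧ d R (extend ρ x)
  ⟦ ex φ ⟧        d R ρ = Σ _ (λ x → ⟦ φ ⟧ d R (extend ρ x))

  pair : {X : Set} → X → X → Fin 2 → X
  pair x y zero    = x
  pair x y (suc _) = y

-- The induced order is x <' y iff d(x,y) ≤ F₂ and x < y: the F₂-classes sit inside
-- (F₁ ∨ F₂)-classes, on which < is total modulo F₁, and two points of one F₂-class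
-- that are F₁-equivalent are (F₁ ∧ F₂)-equivalent.
module Submission where

open import Defs
open import Data.Product using (Σ; _,_; _×_; proj₁)
open import Data.Sum using (_⊎_; inj₁; inj₂)
open import Data.Fin using (zero; suc)

module _ (Λ : FinDistLattice) where
  open FinDistLattice Λ
    using (Carrier; _≤_; _≈_; _∧_; _∨_; x∧y≤x; x∧y≤y; ∧-greatest; ∨-least; reflexive; module Eq)
    renaming (trans to ≤-trans)

  restrictTo : Carrier → Formula Λ 2
  restrictTo F = and (dist≤ F zero (suc zero)) (lt zero (suc zero))

  module _ {X : Set} {d : X → X → Carrier} (ultrametric : IsUltrametric Λ d) where
    open IsUltrametric ultrametric

    rel-sym : ∀ {l} x y → rel Λ d l x y → rel Λ d l y x
    rel-sym x y p = ≤-trans (reflexive (sym y x)) p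

    rel-trans : ∀ {l} x y z → rel Λ d l x y → rel Λ d l y z → rel Λ d l x z
    rel-trans x y z p q = ≤-trans (ultra x y z) (∨-least p q)

    rel-mono : ∀ {l m} {x y} → l ≤ m → rel Λ d l x y → rel Λ d m x y
    rel-mono l≤m p = ≤-trans p l≤m

    restrict-isSubquotientOrder :
      ∀ {E F F' G} {R : X → X → Set} → E ≈ F ∧ F' → F' ≤ G →
      IsSubquotientOrder Λ d F G R →
      IsSubquotientOrder Λ d E F' (λ x y → ⟦_⟧ Λ (restrictTo F') d R (pair Λ x y))
    restrict-isSubquotientOrder {E} {F} {F'} {G} {R} E≈F∧F' F'≤G S = record
      { E≤F          = E≤F'
      ; respects     = λ x x' y y' xx' yy' (xy , x<y) →
          rel-trans x' x y' (rel-sym x x' (rel-mono E≤F' xx'))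
                    (rel-trans x y y' xy (rel-mono E≤F' yy'))
          , S.respects x x' y y' (rel-mono E≤F xx') (rel-mono E≤F yy') x<y
      ; irrefl       = λ x (_ , x<x) → S.irrefl x x<x
      ; trans        = λ x y z (xy , x<y) (yz , y<z) →
          rel-trans x y z xy yz , S.trans x y z x<y y<z
      ; comparable⇒F = λ x y → proj₁
      ; F⇒comparable = λ x y xy → compare x y xy (S.F⇒comparable x y (rel-mono F'≤G xy))
      }
      where
      module S = IsSubquotientOrder S

      E≤F : E ≤ F
      E≤F = ≤-trans (reflexive E≈F∧F') (x∧y≤x F F')

      E≤F' : E ≤ F'
      E≤F' = ≤-trans (reflexive E≈F∧F') (x∧y≤y F F')

      compare : ∀ x y → rel Λ d F' x y → rel Λ d F x y ⊎ (R x y ⊎ R y x) →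
                rel Λ d E x y ⊎ ((rel Λ d F' x y × R x y) ⊎ (rel Λ d F' y x × R y x))
      compare x y xy (inj₁ xFy)        = inj₁ (≤-trans (∧-greatest xFy xy) (reflexive (Eq.sym E≈F∧F')))
      compare x y xy (inj₂ (inj₁ x<y)) = inj₂ (inj₁ (xy , x<y))
      compare x y xy (inj₂ (inj₂ y<x)) = inj₂ (inj₂ (rel-sym x y xy , y<x))

lemma3p8 : (Λ : FinDistLattice) →
           let open FinDistLattice Λ in
           (Γ : UltrametricSpace Λ) → IsGeneric Λ Γ →
           let open UltrametricSpace Γ in
           (E F₁ F₂ : Carrier) → E ≈ (F₁ ∧ F₂) →
           (R : Pt → Pt → Set) →
           IsSubquotientOrder Λ dist F₁ (F₁ ∨ F₂) R →
           Σ (Formula Λ 2) (λ φ →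
             IsSubquotientOrder Λ dist E F₂
               (λ x y → ⟦_⟧ Λ φ dist R (pair Λ x y)))
lemma3p8 Λ Γ _ E F₁ F₂ E≈F₁∧F₂ R S =
  restrictTo Λ F₂ ,
  restrict-isSubquotientOrder Λ isUltrametric E≈F₁∧F₂ (FinDistLattice.y≤x∨y Λ F₁ F₂) S
  where open UltrametricSpace Γ
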